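{- Let $P$ be a lattice polytope cut out by the root system $F_4$ whose facet normals are exactly the rays spanned by the roots of $F_4$. Then $P$ is not diagonally split for any integer $q \ge 2$.
   Context: Coordinates: $N_{\mathbb{R}} = \mathbb{R}^4$, the roots of $F_4$ are $\{\pm e_i,\ \pm e_i \pm e_j\ (i\ne j),\ (\pm\tfrac12,\pm\tfrac12,\pm\tfrac12,\pm\tfrac12)\}$, the root lattice is $N = \mathbb{Z}^4 + \mathbb{Z}\cdot(\tfrac12,\tfrac12,\tfrac12,\tfrac12)$, and its dual lattice $M = \mathrm{Hom}(N,\mathbb{Z})$ is $\{a \in \mathbb{Z}^4 : a_1+a_2+a_3+a_4 \text{ even}\}$, with $M_{\mathbb{R}} = \mathbb{R}^4$. A lattice polytope $P \subset M_{\mathbb{R}}$ has vertices in $M$; it is cut out by $F_4$ if each facet normal is spanned by a root. For a lattice polytope $P$ with primitive inward facet normals $v_1,\dots,v_s \in N$, the diagonal splitting polytope is $\mathbb{F}_P = \{u \in M_{\mathbb{R}} : -1 \le \langle u, v_i\rangle \le 1 \text{ for all } i\}$. For an integer $q \ge 2$, $P$ is diagonally split for $q$ if the interior of $\mathbb{F}_P$ contains representatives of every equivalence class in $\frac{1}{q}M/M$. -}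

module Defs where

open import Data.Nat as ℕ using (ℕ; _<_; _≤_; _*_)
open import Data.Integer as ℤ using (ℤ; +_; -_; ∣_∣)
open import Data.Fin using (Fin; _≟_)
open import Data.Fin.Base using () renaming (zero to fzero)
open import Data.Vec using (Vec; []; _∷_; zipWith; map; tabulate; foldr; replicate; lookup; head; tail; toList)
open import Data.List using (List; concatMap; allFin) renaming ([] to []ₗ; _∷_ to _∷ₗ_)
open import Data.List.Membership.Propositional using (_∈_)
open import Data.Product using (Σ; ∃; ∃-syntax; _×_)
open import Data.Sum using (_⊎_)
open import Relation.Nullary using (does)
open import Relation.Binary.PropositionalEquality using (_≡_)
open import Data.Bool using (if_then_else_)

-- Elements of N = ℤ⁴ + ℤ·(½,½,½,½) are stored by their DOUBLED
-- coordinates: the integer vector w represents the point w/2 ∈ N_ℝ.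

Z4 : Set
Z4 = Vec ℤ 4

_+v_ : Z4 → Z4 → Z4
_+v_ = zipWith ℤ._+_

_-v_ : Z4 → Z4 → Z4
_-v_ = zipWith ℤ._-_

_·v_ : ℤ → Z4 → Z4
c ·v v = map (c ℤ.*_) v

0v : Z4
0v = replicate 4 (+ 0)

dot : Z4 → Z4 → ℤ
dot a b = foldr _ ℤ._+_ (+ 0) (zipWith ℤ._*_ a b)

-- For a ∈ M and w the doubled coordinates of v ∈ N:
--   dot a w = 2 · ⟨a , v⟩.

Even : ℤ → Set
Even z = ∃[ k ] z ≡ (+ 2) ℤ.* k

Odd : ℤ → Set
Odd z = ∃[ k ] z ≡ (+ 2) ℤ.* k ℤ.+ (+ 1)

InM : Z4 → Set
InM a = Even (foldr _ ℤ._+_ (+ 0) a)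

InN : Z4 → Set
InN w = (∀ i → Even (lookup w i)) ⊎ (∀ i → Odd (lookup w i))

Primitive : Z4 → Set
Primitive w = InN w × (∀ (k : ℕ) (u : Z4) → InN u → (+ k) ·v u ≡ w → k ≡ 1)

-- The roots of F₄, in doubled coordinates:
--   ±e_i ↦ ±2e_i,  ±e_i±e_j (i≠j) ↦ ±2e_i±2e_j,  (±½,±½,±½,±½) ↦ (±1,±1,±1,±1).

unit : Fin 4 → ℤ → Z4
unit i c = tabulate (λ j → if does (i ≟ j) then c else + 0)

twoSigns : List ℤ
twoSigns = + 2 ∷ₗ - (+ 2) ∷ₗ []ₗ

shortRoots : List Z4
shortRoots = concatMap (λ i → Data.List.map (unit i) twoSigns) (allFin 4)

longRoots : List Z4
longRoots =
  concatMap (λ i → concatMap (λ j →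
    if does (i ≟ j) then []ₗ
    else concatMap (λ s → Data.List.map (λ t → unit i s +v unit j t) twoSigns) twoSigns)
    (allFin 4)) (allFin 4)

signVecs : (n : ℕ) → List (Vec ℤ n)
signVecs ℕ.zero = [] ∷ₗ []ₗ
signVecs (ℕ.suc n) = concatMap (λ v → (+ 1 ∷ v) ∷ₗ (- (+ 1) ∷ v) ∷ₗ []ₗ) (signVecs n)

halfRoots : List Z4
halfRoots = signVecs 4

rootsF4 : List Z4
rootsF4 = shortRoots Data.List.++ longRoots Data.List.++ halfRoots

IsRoot : Z4 → Set
IsRoot r = r ∈ rootsF4

SameRay : Z4 → Z4 → Set
SameRay w r = ∃[ a ] ∃[ b ] (0 < a × 0 < b × (+ a) ·v w ≡ (+ b) ·v r)

-- Linear independence (over ℤ, equivalently over ℚ by clearing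
-- denominators) of a finite family of vectors.

lincomb : ∀ {k} → Vec ℤ k → Vec Z4 k → Z4
lincomb [] [] = 0v
lincomb (c ∷ cs) (d ∷ ds) = (c ·v d) +v lincomb cs ds

LinIndep : ∀ {k} → Vec Z4 k → Set
LinIndep {k} ds = ∀ (c : Vec ℤ k) → lincomb c ds ≡ 0v → c ≡ replicate k (+ 0)

-- Lattice polytope P = conv(V), V a finite list of points of M.

-- differences from the first point (affine independence)
diffs : ∀ {k} → Vec Z4 (ℕ.suc k) → Vec Z4 k
diffs ps = map (λ p → p -v head ps) (tail ps)

FullDim : List Z4 → Set
FullDim V = Σ (Vec Z4 5) λ ps → (∀ i → lookup ps i ∈ V) × LinIndep (diffs ps)

-- w (doubled coordinates) is a primitive inward facet normal of conv V:
-- w is primitive in N and the face of conv V on which ⟨·,w⟩ is minimal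
-- contains 4 affinely independent points of V (i.e. is 3-dimensional).
IsFacetNormal : List Z4 → Z4 → Set
IsFacetNormal V w =
  Primitive w ×
  (Σ (Vec Z4 4) λ ps →
     (∀ i → lookup ps i ∈ V) ×
     (∀ i x → x ∈ V → dot (lookup ps i) w ℤ.≤ dot x w) ×
     LinIndep (diffs ps))

-- The facet normals of conv V are exactly the rays spanned by the roots of F₄
-- (this includes "cut out by F₄").
FacetNormalsExactlyF4 : List Z4 → Set
FacetNormalsExactlyF4 V =
  (∀ w → IsFacetNormal V w → ∃[ r ] (IsRoot r × SameRay w r)) ×
  (∀ r → IsRoot r → ∃[ w ] (IsFacetNormal V w × SameRay w r))

-- Diagonally split for q: every class [m/q] ∈ (1/q)M/M (m ∈ M) has a
-- representative u = m/q + m' (m' ∈ M) in the interior of 𝔽_P, i.e.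
-- |⟨u , v⟩| < 1 for every primitive inward facet normal v.  With w the
-- doubled coordinates of v this reads |dot (m + q m') w| < 2q.
DiagonallySplit : List Z4 → ℕ → Set
DiagonallySplit V q =
  ∀ m → InM m → ∃[ m' ] (InM m' ×
    (∀ w → IsFacetNormal V w → ∣ dot (m +v ((+ q) ·v m')) w ∣ < 2 * q))

module Submission where

-- Work with doubled coordinates for N, so that a point u of
-- M + qM satisfies the splitting condition for a facet normal w iff
-- |⟨u,w⟩| < 2q.  We exhibit one class [m/q] none of whose representatives
-- u = m + q m' lies in the interior of the diagonal splitting polytope.
--
-- If w ∈ N spans the same ray as a root r with a zero coordinate
--     (a root ±eᵢ or ±eᵢ±eⱼ), then w is an integer multiple of r/2, hence
--     |⟨u,r⟩| ≤ |⟨u,w⟩| for every u.  So a representative u violates the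
--     condition as soon as |⟨u,r⟩| ≥ 2q for such a root; we call this an
--     obstruction of u.
--  2. Windows.  For 0 ≤ n < q the integer n + q a has absolute value ≥ q
--     unless a ∈ {0,-1}; a coordinate of absolute value ≥ q is obstructed by
--     the short root 2eₖ.
--  3. The class.  Write q = 2j+2 or q = 2j+3 and take m = (j+1, j+1, j, j+2).
--     After step 2 only the choices mᵢ or mᵢ - q remain for each coordinate
--     of u; a short decision tree (using that m' ∈ M has even coordinate sum
--     when q is odd) finds in every case a long root 2e₁ ± 2eₖ with
--     |⟨u,r⟩| ≥ 2q.
--
-- The theorem follows because every root ray carries a facet normal.

open import Defs
open import Data.Nat as ℕ using (ℕ; zero; suc; _≤_; _<_; _*_; z≤n; s≤s)
open import Data.Nat.Properties as ℕP using (module ≤-Reasoning)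
open import Data.Integer as ℤ using (ℤ; +_; -[1+_]; ∣_∣; +0; +[1+_])
open import Data.Integer.Properties as ℤP using (abs-*)
open import Data.Integer.Tactic.RingSolver using (solve-∀)
open import Data.Fin using (Fin) renaming (zero to f0; suc to fs)
open import Data.Vec using (_∷_; []; lookup)
open import Data.Vec.Properties using (lookup-map; ≡-dec)
open import Data.List using (List)
open import Data.List.Relation.Unary.All using (All)
import Data.List.Membership.DecPropositional as DecMembership
open import Data.Product using (_×_; _,_; proj₁; ∃-syntax)
open import Data.Sum using (_⊎_; inj₁; inj₂; [_,_]′)
open import Data.Empty using (⊥-elim)
open import Function using (id)
open import Relation.Nullary using (¬_)
open import Relation.Nullary.Decidable using (True; toWitness)
open import Relation.Binary.PropositionalEquality

open DecMembership (≡-dec {n = 4} ℤ._≟_) using (_∈?_)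

odd-≢0 : ¬ Odd (+ 0)
odd-≢0 (+0 , ())
odd-≢0 (+[1+ n ] , ())
odd-≢0 (-[1+ zero ] , ())
odd-≢0 (-[1+ suc n ] , ())

even-≢-1 : ¬ Even -[1+ 0 ]
even-≢-1 (+0 , ())
even-≢-1 (+[1+ n ] , ())
even-≢-1 (-[1+ zero ] , ())
even-≢-1 (-[1+ suc n ] , ())

even-nonzero-≥2 : ∀ {x} → Even x → ∣ x ∣ ≢ 0 → 2 ≤ ∣ x ∣
even-nonzero-≥2 {x} (k , x≡2k) x≢0 = double-≥2 ∣ k ∣ (trans (cong ∣_∣ x≡2k) (abs-* (+ 2) k))
  where
  double-≥2 : ∀ n → ∣ x ∣ ≡ 2 * n → 2 ≤ ∣ x ∣
  double-≥2 zero    e = ⊥-elim (x≢0 e)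
  double-≥2 (suc n) e = subst (2 ≤_) (sym e) (ℕP.m≤m*n 2 (suc n))

dot-scale : ∀ (u w : Z4) c → dot u (c ·v w) ≡ c ℤ.* dot u w
dot-scale (x₁ ∷ x₂ ∷ x₃ ∷ x₄ ∷ []) (y₁ ∷ y₂ ∷ y₃ ∷ y₄ ∷ []) c = expand x₁ x₂ x₃ x₄ y₁ y₂ y₃ y₄ c
  where
  expand : ∀ x₁ x₂ x₃ x₄ y₁ y₂ y₃ y₄ c →
    x₁ ℤ.* (c ℤ.* y₁) ℤ.+ (x₂ ℤ.* (c ℤ.* y₂) ℤ.+ (x₃ ℤ.* (c ℤ.* y₃) ℤ.+ (x₄ ℤ.* (c ℤ.* y₄) ℤ.+ + 0)))
    ≡ c ℤ.* (x₁ ℤ.* y₁ ℤ.+ (x₂ ℤ.* y₂ ℤ.+ (x₃ ℤ.* y₃ ℤ.+ (x₄ ℤ.* y₄ ℤ.+ + 0))))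
  expand = solve-∀

dot-+v : ∀ (u v w : Z4) → dot u (v +v w) ≡ dot u v ℤ.+ dot u w
dot-+v (x₁ ∷ x₂ ∷ x₃ ∷ x₄ ∷ []) (y₁ ∷ y₂ ∷ y₃ ∷ y₄ ∷ []) (z₁ ∷ z₂ ∷ z₃ ∷ z₄ ∷ []) =
  expand x₁ x₂ x₃ x₄ y₁ y₂ y₃ y₄ z₁ z₂ z₃ z₄
  where
  expand : ∀ x₁ x₂ x₃ x₄ y₁ y₂ y₃ y₄ z₁ z₂ z₃ z₄ →
    x₁ ℤ.* (y₁ ℤ.+ z₁) ℤ.+ (x₂ ℤ.* (y₂ ℤ.+ z₂) ℤ.+ (x₃ ℤ.* (y₃ ℤ.+ z₃) ℤ.+ (x₄ ℤ.* (y₄ ℤ.+ z₄) ℤ.+ + 0)))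
    ≡ (x₁ ℤ.* y₁ ℤ.+ (x₂ ℤ.* y₂ ℤ.+ (x₃ ℤ.* y₃ ℤ.+ (x₄ ℤ.* y₄ ℤ.+ + 0))))
      ℤ.+ (x₁ ℤ.* z₁ ℤ.+ (x₂ ℤ.* z₂ ℤ.+ (x₃ ℤ.* z₃ ℤ.+ (x₄ ℤ.* z₄ ℤ.+ + 0))))
  expand = solve-∀

dot-unit : ∀ (u : Z4) i c → dot u (unit i c) ≡ c ℤ.* lookup u i
dot-unit (x₁ ∷ x₂ ∷ x₃ ∷ x₄ ∷ []) f0 c = expand x₁ x₂ x₃ x₄ c
  where
  expand : ∀ x₁ x₂ x₃ x₄ c →
    x₁ ℤ.* c ℤ.+ (x₂ ℤ.* + 0 ℤ.+ (x₃ ℤ.* + 0 ℤ.+ (x₄ ℤ.* + 0 ℤ.+ + 0))) ≡ c ℤ.* x₁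
  expand = solve-∀
dot-unit (x₁ ∷ x₂ ∷ x₃ ∷ x₄ ∷ []) (fs f0) c = expand x₁ x₂ x₃ x₄ c
  where
  expand : ∀ x₁ x₂ x₃ x₄ c →
    x₁ ℤ.* + 0 ℤ.+ (x₂ ℤ.* c ℤ.+ (x₃ ℤ.* + 0 ℤ.+ (x₄ ℤ.* + 0 ℤ.+ + 0))) ≡ c ℤ.* x₂
  expand = solve-∀
dot-unit (x₁ ∷ x₂ ∷ x₃ ∷ x₄ ∷ []) (fs (fs f0)) c = expand x₁ x₂ x₃ x₄ c
  where
  expand : ∀ x₁ x₂ x₃ x₄ c →
    x₁ ℤ.* + 0 ℤ.+ (x₂ ℤ.* + 0 ℤ.+ (x₃ ℤ.* c ℤ.+ (x₄ ℤ.* + 0 ℤ.+ + 0))) ≡ c ℤ.* x₃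
  expand = solve-∀
dot-unit (x₁ ∷ x₂ ∷ x₃ ∷ x₄ ∷ []) (fs (fs (fs f0))) c = expand x₁ x₂ x₃ x₄ c
  where
  expand : ∀ x₁ x₂ x₃ x₄ c →
    x₁ ℤ.* + 0 ℤ.+ (x₂ ℤ.* + 0 ℤ.+ (x₃ ℤ.* + 0 ℤ.+ (x₄ ℤ.* c ℤ.+ + 0))) ≡ c ℤ.* x₄
  expand = solve-∀

scaled-abs : ∀ {a b} {x y : ℤ} → + a ℤ.* x ≡ + b ℤ.* y → a * ∣ x ∣ ≡ b * ∣ y ∣
scaled-abs {a} {b} {x} {y} e = trans (sym (abs-* (+ a) x)) (trans (cong ∣_∣ e) (abs-* (+ b) y))

scale-≤ : ∀ {a b c d} → a * c ≡ b * d → 0 < d → d ≤ c → a ≤ b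
scale-≤ {a} {b} {c} {d} e 0<d d≤c =
  ℕP.*-cancelʳ-≤ a b d {{ℕ.>-nonZero 0<d}} (subst (a * d ≤_) e (ℕP.*-monoʳ-≤ a d≤c))

ray-coord : ∀ {a b} {w r : Z4} → (+ a) ·v w ≡ (+ b) ·v r → ∀ i →
            + a ℤ.* lookup w i ≡ + b ℤ.* lookup r i
ray-coord {a} {b} {w} {r} eq i = begin
  + a ℤ.* lookup w i       ≡⟨ lookup-map i (+ a ℤ.*_) w ⟨
  lookup ((+ a) ·v w) i    ≡⟨ cong (λ v → lookup v i) eq ⟩
  lookup ((+ b) ·v r) i    ≡⟨ lookup-map i (+ b ℤ.*_) r ⟩
  + b ℤ.* lookup r i       ∎
  where open ≡-Reasoning

-- If w lies on the ray of r and dominates it in one nonzero coordinate, then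
-- w is a multiple b/a ≥ 1 of r, so w dominates r in every dot product.
ray-dominates : ∀ {w r} (u : Z4) i → SameRay w r → 0 < ∣ lookup r i ∣ →
                ∣ lookup r i ∣ ≤ ∣ lookup w i ∣ → ∣ dot u r ∣ ≤ ∣ dot u w ∣
ray-dominates {w} {r} u i (a , b , 0<a , _ , eq) ri>0 ri≤wi =
  ℕP.*-cancelˡ-≤ a {{ℕ.>-nonZero 0<a}} (begin
    a * ∣ dot u r ∣   ≤⟨ ℕP.*-monoˡ-≤ ∣ dot u r ∣ a≤b ⟩
    b * ∣ dot u r ∣   ≡⟨ scaled-abs {a} {b} dot-on-ray ⟨
    a * ∣ dot u w ∣   ∎)
  where
  open ≤-Reasoning
  a≤b : a ≤ b
  a≤b = scale-≤ {a} {b} (scaled-abs {a} {b} (ray-coord {a} {b} eq i)) ri>0 ri≤wi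
  dot-on-ray : + a ℤ.* dot u w ≡ + b ℤ.* dot u r
  dot-on-ray = trans (sym (dot-scale u w (+ a))) (trans (cong (dot u) eq) (dot-scale u r (+ b)))

-- A vector of N on the ray of a root r with a zero coordinate has that
-- coordinate zero, hence all coordinates even (doubled coordinates of N are
-- all even or all odd); where r has coordinate 2 it is therefore ≥ 2.
ray-coord-≥2 : ∀ {w r} → InN w → SameRay w r → ∀ {l i} →
               lookup r l ≡ + 0 → lookup r i ≡ + 2 → 2 ≤ ∣ lookup w i ∣
ray-coord-≥2 {w} {r} w∈N (a , b , 0<a , 0<b , eq) {l} {i} rₗ≡0 rᵢ≡2 =
  even-nonzero-≥2 (w-even i) wᵢ≢0
  where
  coord : ∀ k → a * ∣ lookup w k ∣ ≡ b * ∣ lookup r k ∣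
  coord k = scaled-abs {a} {b} (ray-coord {a} {b} eq k)
  wₗ≡0 : lookup w l ≡ + 0
  wₗ≡0 with ℕP.m*n≡0⇒m≡0∨n≡0 a (trans (coord l) (trans (cong (λ x → b * ∣ x ∣) rₗ≡0) (ℕP.*-zeroʳ b)))
  ... | inj₁ refl = ⊥-elim (ℕP.<-irrefl refl 0<a)
  ... | inj₂ ∣wₗ∣≡0 = ℤP.∣i∣≡0⇒i≡0 ∣wₗ∣≡0
  w-even : ∀ k → Even (lookup w k)
  w-even = [ id , (λ w-odd → ⊥-elim (odd-≢0 (subst Odd wₗ≡0 (w-odd l)))) ]′ w∈N
  wᵢ≢0 : ∣ lookup w i ∣ ≢ 0
  wᵢ≢0 ∣wᵢ∣≡0 with ℕP.m*n≡0⇒m≡0∨n≡0 b (trans (cong (λ x → b * ∣ x ∣) (sym rᵢ≡2))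
                     (trans (sym (coord i)) (trans (cong (a *_) ∣wᵢ∣≡0) (ℕP.*-zeroʳ a))))
  ... | inj₁ refl = ℕP.<-irrefl refl 0<b
  ... | inj₂ ()

record Obstruction (u : Z4) (q : ℕ) : Set where
  field
    root      : Z4
    isRoot    : IsRoot root
    zeroAt    : Fin 4
    twoAt     : Fin 4
    root-zero : lookup root zeroAt ≡ + 0
    root-two  : lookup root twoAt ≡ + 2
    large     : 2 * q ≤ ∣ dot u root ∣

obstruction-violates : ∀ {V u q} →
  (∀ r → IsRoot r → ∃[ w ] (IsFacetNormal V w × SameRay w r)) →
  Obstruction u q → ¬ (∀ w → IsFacetNormal V w → ∣ dot u w ∣ < 2 * q)
obstruction-violates {u = u} rays o inside with rays (Obstruction.root o) (Obstruction.isRoot o)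
... | w , normal , sameRay = ℕP.<⇒≱ (inside w normal) (ℕP.≤-trans large dominated)
  where
  open Obstruction o
  dominated : ∣ dot u root ∣ ≤ ∣ dot u w ∣
  dominated = ray-dominates u twoAt sameRay (subst (λ x → 0 < ∣ x ∣) (sym root-two) (s≤s z≤n))
                (subst (λ x → ∣ x ∣ ≤ ∣ lookup w twoAt ∣) (sym root-two)
                  (ray-coord-≥2 (proj₁ (proj₁ normal)) sameRay root-zero root-two))

obstructed-class : ∀ {V q} → (∀ r → IsRoot r → ∃[ w ] (IsFacetNormal V w × SameRay w r)) →
  ∀ m → InM m → (∀ m' → InM m' → Obstruction (m +v ((+ q) ·v m')) q) → ¬ DiagonallySplit V q
obstructed-class rays m m∈M obstructed split with split m m∈M
... | m' , m'∈M , inside = obstruction-violates rays (obstructed m' m'∈M) inside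

sumRoot diffRoot : Fin 4 → Z4
sumRoot k = unit f0 (+ 2) +v unit k (+ 2)
diffRoot k = unit f0 (+ 2) +v unit k (ℤ.- + 2)

dot-sumRoot : ∀ (u : Z4) k → dot u (sumRoot k) ≡ + 2 ℤ.* (lookup u f0 ℤ.+ lookup u k)
dot-sumRoot u k = begin
  dot u (sumRoot k)                                     ≡⟨ dot-+v u (unit f0 (+ 2)) (unit k (+ 2)) ⟩
  dot u (unit f0 (+ 2)) ℤ.+ dot u (unit k (+ 2))        ≡⟨ cong₂ ℤ._+_ (dot-unit u f0 (+ 2)) (dot-unit u k (+ 2)) ⟩
  + 2 ℤ.* lookup u f0 ℤ.+ + 2 ℤ.* lookup u k            ≡⟨ ℤP.*-distribˡ-+ (+ 2) (lookup u f0) (lookup u k) ⟨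
  + 2 ℤ.* (lookup u f0 ℤ.+ lookup u k)                  ∎
  where open ≡-Reasoning

dot-diffRoot : ∀ (u : Z4) k → dot u (diffRoot k) ≡ + 2 ℤ.* (lookup u f0 ℤ.- lookup u k)
dot-diffRoot u k = begin
  dot u (diffRoot k)                                    ≡⟨ dot-+v u (unit f0 (+ 2)) (unit k (ℤ.- + 2)) ⟩
  dot u (unit f0 (+ 2)) ℤ.+ dot u (unit k (ℤ.- + 2))    ≡⟨ cong₂ ℤ._+_ (dot-unit u f0 (+ 2)) (dot-unit u k (ℤ.- + 2)) ⟩
  + 2 ℤ.* lookup u f0 ℤ.+ ℤ.- + 2 ℤ.* lookup u k        ≡⟨ factor (lookup u f0) (lookup u k) ⟩
  + 2 ℤ.* (lookup u f0 ℤ.- lookup u k)                  ∎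
  where
  open ≡-Reasoning
  factor : ∀ x y → + 2 ℤ.* x ℤ.+ ℤ.- (+ 2) ℤ.* y ≡ + 2 ℤ.* (x ℤ.- y)
  factor = solve-∀

module _ {q : ℕ} (u : Z4) where

  viaRoot : ∀ r {r∈F₄ : True (r ∈? rootsF4)} → ∀ l → lookup r l ≡ + 0 → ∀ i → lookup r i ≡ + 2 →
            ∀ {y} → dot u r ≡ + 2 ℤ.* y → q ≤ ∣ y ∣ → Obstruction u q
  viaRoot r {r∈F₄} l rₗ≡0 i rᵢ≡2 {y} dot≡2y q≤∣y∣ = record
    { root = r ; isRoot = toWitness r∈F₄ ; zeroAt = l ; twoAt = i
    ; root-zero = rₗ≡0 ; root-two = rᵢ≡2
    ; large = subst (2 * q ≤_) (sym (trans (cong ∣_∣ dot≡2y) (abs-* (+ 2) y))) (ℕP.*-monoʳ-≤ 2 q≤∣y∣)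
    }

  short : ∀ k → q ≤ ∣ lookup u k ∣ → Obstruction u q
  short f0 = viaRoot (unit f0 (+ 2)) (fs f0) refl f0 refl (dot-unit u f0 (+ 2))
  short (fs f0) = viaRoot (unit (fs f0) (+ 2)) f0 refl (fs f0) refl (dot-unit u (fs f0) (+ 2))
  short (fs (fs f0)) =
    viaRoot (unit (fs (fs f0)) (+ 2)) f0 refl (fs (fs f0)) refl
      (dot-unit u (fs (fs f0)) (+ 2))
  short (fs (fs (fs f0))) =
    viaRoot (unit (fs (fs (fs f0))) (+ 2)) f0 refl (fs (fs (fs f0))) refl
      (dot-unit u (fs (fs (fs f0))) (+ 2))

  sum₁₂ : q ≤ ∣ lookup u f0 ℤ.+ lookup u (fs f0) ∣ → Obstruction u q
  sum₁₂ = viaRoot (sumRoot (fs f0)) (fs (fs f0)) refl f0 refl (dot-sumRoot u (fs f0))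

  diff₁₂ : q ≤ ∣ lookup u f0 ℤ.- lookup u (fs f0) ∣ → Obstruction u q
  diff₁₂ = viaRoot (diffRoot (fs f0)) (fs (fs f0)) refl f0 refl (dot-diffRoot u (fs f0))

  sum₁₄ : q ≤ ∣ lookup u f0 ℤ.+ lookup u (fs (fs (fs f0))) ∣ → Obstruction u q
  sum₁₄ = viaRoot (sumRoot (fs (fs (fs f0)))) (fs f0) refl f0 refl
            (dot-sumRoot u (fs (fs (fs f0))))

  diff₁₃ : q ≤ ∣ lookup u f0 ℤ.- lookup u (fs (fs f0)) ∣ → Obstruction u q
  diff₁₃ = viaRoot (diffRoot (fs (fs f0))) (fs f0) refl f0 refl
             (dot-diffRoot u (fs (fs f0)))

beyond : ∀ {q y} c → (y ≡ + (q ℕ.+ c)) ⊎ (y ≡ ℤ.- + (q ℕ.+ c)) → q ≤ ∣ y ∣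
beyond {q} c (inj₁ refl) = ℕP.m≤m+n q c
beyond {q} c (inj₂ refl) = subst (q ≤_) (sym (ℤP.∣-i∣≡∣i∣ (+ (q ℕ.+ c)))) (ℕP.m≤m+n q c)

data Window (q n : ℕ) : ℤ → Set where
  stay : Window q n (+ 0)
  wrap : Window q n (ℤ.- + 1)
  far  : ∀ {a} → q ≤ ∣ + n ℤ.+ + q ℤ.* a ∣ → Window q n a

window : ∀ {q n} → n < q → ∀ a → Window q n a
window n<q +0 = stay
window n<q -[1+ zero ] = wrap
window {q} {n} n<q +[1+ t ] =
  far (subst (λ x → q ≤ ∣ + n ℤ.+ x ∣) (ℤP.pos-* q (suc t))
        (ℕP.≤-trans (ℕP.m≤m*n q (suc t)) (ℕP.m≤n+m (q * suc t) n)))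
window {q} {n} n<q a@(-[1+ suc t ]) = far (ℕP.+-cancelʳ-≤ q q ∣ x ∣ (begin
  q ℕ.+ q                    ≤⟨ ℕP.+-monoʳ-≤ q (ℕP.m≤m*n q (suc t)) ⟩
  q ℕ.+ q * suc t            ≡⟨ ℕP.*-suc q (suc t) ⟨
  q * ∣ a ∣                  ≡⟨ abs-* (+ q) a ⟨
  ∣ + q ℤ.* a ∣              ≡⟨ cong ∣_∣ (shift (+ n) (+ q ℤ.* a)) ⟩
  ∣ x ℤ.+ ℤ.- + n ∣          ≤⟨ ℤP.∣i+j∣≤∣i∣+∣j∣ x (ℤ.- + n) ⟩
  ∣ x ∣ ℕ.+ ∣ ℤ.- + n ∣       ≡⟨ cong (∣ x ∣ ℕ.+_) (ℤP.∣-i∣≡∣i∣ (+ n)) ⟩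
  ∣ x ∣ ℕ.+ n                ≤⟨ ℕP.+-monoʳ-≤ ∣ x ∣ (ℕP.<⇒≤ n<q) ⟩
  ∣ x ∣ ℕ.+ q                ∎))
  where
  open ≤-Reasoning
  x : ℤ
  x = + n ℤ.+ + q ℤ.* a
  shift : ∀ n z → z ≡ (n ℤ.+ z) ℤ.+ ℤ.- n
  shift = solve-∀

data Size : ℕ → Set where
  even : ∀ j → Size (j ℕ.+ j ℕ.+ 2)
  odd  : ∀ j → Size (j ℕ.+ j ℕ.+ 3)

size : ∀ q → 2 ≤ q → Size q
size (suc zero) (s≤s ())
size (suc (suc q)) _ = grow q
  where
  next : ∀ {n} → Size n → Size (suc (suc n))
  next (even j) = subst Size (cong (λ n → suc (n ℕ.+ 2)) (ℕP.+-suc j j)) (even (suc j))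
  next (odd j)  = subst Size (cong (λ n → suc (n ℕ.+ 3)) (ℕP.+-suc j j)) (odd (suc j))
  grow : ∀ q → Size (suc (suc q))
  grow zero = even 0
  grow (suc zero) = odd 0
  grow (suc (suc q)) = next (grow q)

badClass : ℕ → Z4
badClass j = (+ j ℤ.+ + 1) ∷ (+ j ℤ.+ + 1) ∷ + j ∷ (+ j ℤ.+ + 2) ∷ []

badClass∈M : ∀ j → InM (badClass j)
badClass∈M j = (P ℤ.+ P ℤ.+ + 2) , coordinate-sum P
  where
  P = + j
  coordinate-sum : ∀ P → (P ℤ.+ + 1) ℤ.+ ((P ℤ.+ + 1) ℤ.+ (P ℤ.+ ((P ℤ.+ + 2) ℤ.+ + 0)))
                         ≡ + 2 ℤ.* (P ℤ.+ P ℤ.+ + 2)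
  coordinate-sum = solve-∀

coord<q : ∀ j k l → k < l → j ℕ.+ k < j ℕ.+ j ℕ.+ l
coord<q j k l k<l = ℕP.≤-trans (ℕP.+-monoʳ-< j k<l) (ℕP.+-monoˡ-≤ l (ℕP.m≤m+n j j))

-- q = 2j+2: u₁, u₂ ∈ {q/2, -q/2}, so |u₁ + u₂| = q or |u₁ - u₂| = q.
module EvenCase (j : ℕ) where

  q : ℕ
  q = j ℕ.+ j ℕ.+ 2

  j+1<q : j ℕ.+ 1 < q
  j+1<q = coord<q j 1 2 (s≤s (s≤s z≤n))

  stay+stay : ∀ P → (P ℤ.+ + 1 ℤ.+ (P ℤ.+ P ℤ.+ + 2) ℤ.* + 0) ℤ.+ (P ℤ.+ + 1 ℤ.+ (P ℤ.+ P ℤ.+ + 2) ℤ.* + 0)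
                    ≡ P ℤ.+ P ℤ.+ + 2 ℤ.+ + 0
  stay+stay = solve-∀
  stay-wrap : ∀ P → (P ℤ.+ + 1 ℤ.+ (P ℤ.+ P ℤ.+ + 2) ℤ.* + 0) ℤ.- (P ℤ.+ + 1 ℤ.+ (P ℤ.+ P ℤ.+ + 2) ℤ.* ℤ.- (+ 1))
                    ≡ P ℤ.+ P ℤ.+ + 2 ℤ.+ + 0
  stay-wrap = solve-∀
  wrap-stay : ∀ P → (P ℤ.+ + 1 ℤ.+ (P ℤ.+ P ℤ.+ + 2) ℤ.* ℤ.- (+ 1)) ℤ.- (P ℤ.+ + 1 ℤ.+ (P ℤ.+ P ℤ.+ + 2) ℤ.* + 0)
                    ≡ ℤ.- (P ℤ.+ P ℤ.+ + 2 ℤ.+ + 0)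
  wrap-stay = solve-∀
  wrap+wrap : ∀ P → (P ℤ.+ + 1 ℤ.+ (P ℤ.+ P ℤ.+ + 2) ℤ.* ℤ.- (+ 1)) ℤ.+ (P ℤ.+ + 1 ℤ.+ (P ℤ.+ P ℤ.+ + 2) ℤ.* ℤ.- (+ 1))
                    ≡ ℤ.- (P ℤ.+ P ℤ.+ + 2 ℤ.+ + 0)
  wrap+wrap = solve-∀

  obstructed : ∀ m' → InM m' → Obstruction (badClass j +v ((+ q) ·v m')) q
  obstructed (a ∷ b ∷ c ∷ d ∷ []) _ with window j+1<q a | window j+1<q b
  ... | far h | _      = short _ f0 h
  ... | _     | far h  = short _ (fs f0) h
  ... | stay  | stay   = sum₁₂  _ (beyond 0 (inj₁ (stay+stay (+ j))))
  ... | stay  | wrap   = diff₁₂ _ (beyond 0 (inj₁ (stay-wrap (+ j))))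
  ... | wrap  | stay   = diff₁₂ _ (beyond 0 (inj₂ (wrap-stay (+ j))))
  ... | wrap  | wrap   = sum₁₂  _ (beyond 0 (inj₂ (wrap+wrap (+ j))))

-- q = 2j+3: u₁, u₂ ∈ {j+1, -(j+2)}, u₃ ∈ {j, -(j+3)}, u₄ ∈ {j+2, -(j+1)}.
-- If u₁ ≠ u₂ then |u₁ - u₂| = q, if u₁ = u₂ = -(j+2) then |u₁ + u₂| > q.
-- Otherwise u₁ = u₂ = j+1, and since m' ∈ M the shifts of u₃ and u₄ agree:
-- either u₁ + u₄ = q or u₁ - u₃ = q + 1.
module OddCase (j : ℕ) where

  q : ℕ
  q = j ℕ.+ j ℕ.+ 3

  j+1<q : j ℕ.+ 1 < q
  j+1<q = coord<q j 1 3 (s≤s (s≤s z≤n))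

  j<q : j < q
  j<q = subst (_< q) (ℕP.+-identityʳ j) (coord<q j 0 3 (s≤s z≤n))

  j+2<q : j ℕ.+ 2 < q
  j+2<q = coord<q j 2 3 (s≤s (s≤s (s≤s z≤n)))

  wrap+wrap : ∀ P → (P ℤ.+ + 1 ℤ.+ (P ℤ.+ P ℤ.+ + 3) ℤ.* ℤ.- (+ 1)) ℤ.+ (P ℤ.+ + 1 ℤ.+ (P ℤ.+ P ℤ.+ + 3) ℤ.* ℤ.- (+ 1))
                    ≡ ℤ.- (P ℤ.+ P ℤ.+ + 3 ℤ.+ + 1)
  wrap+wrap = solve-∀
  stay-wrap : ∀ P → (P ℤ.+ + 1 ℤ.+ (P ℤ.+ P ℤ.+ + 3) ℤ.* + 0) ℤ.- (P ℤ.+ + 1 ℤ.+ (P ℤ.+ P ℤ.+ + 3) ℤ.* ℤ.- (+ 1))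
                    ≡ P ℤ.+ P ℤ.+ + 3 ℤ.+ + 0
  stay-wrap = solve-∀
  wrap-stay : ∀ P → (P ℤ.+ + 1 ℤ.+ (P ℤ.+ P ℤ.+ + 3) ℤ.* ℤ.- (+ 1)) ℤ.- (P ℤ.+ + 1 ℤ.+ (P ℤ.+ P ℤ.+ + 3) ℤ.* + 0)
                    ≡ ℤ.- (P ℤ.+ P ℤ.+ + 3 ℤ.+ + 0)
  wrap-stay = solve-∀
  u₁+u₄ : ∀ P → (P ℤ.+ + 1 ℤ.+ (P ℤ.+ P ℤ.+ + 3) ℤ.* + 0) ℤ.+ (P ℤ.+ + 2 ℤ.+ (P ℤ.+ P ℤ.+ + 3) ℤ.* + 0)
                ≡ P ℤ.+ P ℤ.+ + 3 ℤ.+ + 0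
  u₁+u₄ = solve-∀
  u₁-u₃ : ∀ P → (P ℤ.+ + 1 ℤ.+ (P ℤ.+ P ℤ.+ + 3) ℤ.* + 0) ℤ.- (P ℤ.+ (P ℤ.+ P ℤ.+ + 3) ℤ.* ℤ.- (+ 1))
                ≡ P ℤ.+ P ℤ.+ + 3 ℤ.+ + 1
  u₁-u₃ = solve-∀

  obstructed : ∀ m' → InM m' → Obstruction (badClass j +v ((+ q) ·v m')) q
  obstructed (a ∷ b ∷ c ∷ d ∷ []) even-sum with window j+1<q a | window j+1<q b
  ... | far h | _     = short _ f0 h
  ... | _     | far h = short _ (fs f0) h
  ... | wrap  | wrap  = sum₁₂  _ (beyond 1 (inj₂ (wrap+wrap (+ j))))
  ... | stay  | wrap  = diff₁₂ _ (beyond 0 (inj₁ (stay-wrap (+ j))))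
  ... | wrap  | stay  = diff₁₂ _ (beyond 0 (inj₂ (wrap-stay (+ j))))
  ... | stay  | stay  with window j<q c | window j+2<q d
  ...   | far h | _     = short _ (fs (fs f0)) h
  ...   | _     | far h = short _ (fs (fs (fs f0))) h
  ...   | stay  | stay  = sum₁₄  _ (beyond 0 (inj₁ (u₁+u₄ (+ j))))
  ...   | wrap  | wrap  = diff₁₃ _ (beyond 1 (inj₁ (u₁-u₃ (+ j))))
  ...   | stay  | wrap  = ⊥-elim (even-≢-1 even-sum)
  ...   | wrap  | stay  = ⊥-elim (even-≢-1 even-sum)

proposition4p1 : (V : List Z4) → All InM V → FullDim V → FacetNormalsExactlyF4 V →
                 (q : ℕ) → 2 ≤ q → ¬ DiagonallySplit V q
proposition4p1 V _ _ (_ , rays) q 2≤q with size q 2≤q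
... | even j = obstructed-class rays (badClass j) (badClass∈M j) (EvenCase.obstructed j)
... | odd j  = obstructed-class rays (badClass j) (badClass∈M j) (OddCase.obstructed j)
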